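{- Fix an integer base $b \ge 2$ and a function $f_*:\{0,1,\dots,b-1\}\to\mathbb{Z}^{\ge 0}$, and let $f$ be the associated digit map $f\left(\sum_{i=0}^n a_i b^i\right)=\sum_{i=0}^n f_*(a_i)$ (base-$b$ representation). Suppose $f(0)=0$, $f(1)=1$, $\gcd(b,f(b-1))=1$, and there is a digit $0\le m_*\le b-1$ with $\gcd(f(m_*)-m_*,f(b-1))=1$. Let $u$ be a positive integer with $f^r(u)=u$ for some $r\ge1$. Let $h$ be a $u$-integer. Then for every integer $a$ there exists a $u$-integer $l$ such that $l\equiv a \pmod{f(b-1)}$ and such that $l$ and $h$ are concurrently $u$-integers.
   Context: $f^r$ denotes the $r$-fold iterate of $f$. A positive integer $n$ is a $u$-integer if $f^r(n)=u$ for some $r\ge1$. Two positive integers $m,n$ are concurrently $u$-integers if there is a single $r\ge 1$ with $f^r(m)=f^r(n)=u$. -}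

module Defs where

open import Data.Nat using (ℕ; zero; suc; _+_; _≤_; NonZero)
open import Data.Nat.DivMod using (_/_; _mod_)
open import Data.Fin using (Fin)
open import Data.Product using (Σ; _×_)
open import Relation.Binary.PropositionalEquality using (_≡_)

iter : (ℕ → ℕ) → ℕ → ℕ → ℕ
iter f zero    n = n
iter f (suc r) n = f (iter f r n)

digitSumAux : (b : ℕ) → ⦃ _ : NonZero b ⦄ → (Fin b → ℕ) → ℕ → ℕ → ℕ
digitSumAux b fstar zero    n       = 0
digitSumAux b fstar (suc k) zero    = 0
digitSumAux b fstar (suc k) (suc n) =
  fstar (suc n mod b) + digitSumAux b fstar k (suc n / b)

-- the digit map f(∑ a_i b^i) = ∑ fstar(a_i); the representation of 0 is the single digit 0.
digitMap : (b : ℕ) → ⦃ _ : NonZero b ⦄ → (Fin b → ℕ) → ℕ → ℕ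
digitMap b fstar zero    = fstar (0 mod b)
digitMap b fstar (suc n) = digitSumAux b fstar (suc n) (suc n)

IsUInt : (ℕ → ℕ) → ℕ → ℕ → Set
IsUInt f u n = Σ ℕ λ r → (1 ≤ r) × (iter f r n ≡ u)

ConcUInt : (ℕ → ℕ) → ℕ → ℕ → ℕ → Set
ConcUInt f u m n = Σ ℕ λ r → (1 ≤ r) × (iter f r m ≡ u) × (iter f r n ≡ u)

module Submission where

-- Write F = f(b − 1). As b is a unit modulo F, b^e ≡ 1 (mod F) for some e ≥ 1, so padding each
-- digit with e − 1 zeros makes appending a digit d act as x ↦ x + d modulo F, while f just adds
-- f(d). A numeral of k digits m* and o digits 1 thus has f-value o + k f(m*) and residue
-- o + k m* = N − k (f(m*) − m*) where N = o + k f(m*); since f(m*) − m* is a unit modulo F, a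
-- choice of k < F reaches every residue a, and o then fixes N. For N = f(h) b^(F f(m*)), which
-- is large enough and has f(N) = f(f(h)), we get f(f(l)) = f(f(h)); numbers sharing an iterate
-- reach the cycle of u simultaneously.

open import Defs
open import Data.Nat using (ℕ; _≤_; _<_; NonZero)
open import Data.Fin using (Fin; toℕ)
open import Data.Product using (Σ; ∃; _×_)
open import Relation.Binary.PropositionalEquality using (_≡_)

module Iteration (f : ℕ → ℕ) where
  open import Data.Nat
  open import Data.Nat.Properties
  open import Data.Nat.Tactic.RingSolver using (solve-∀)
  open import Data.Product using (_,_)
  open import Relation.Binary.PropositionalEquality

  iter-+ : ∀ m n x → iter f (m + n) x ≡ iter f m (iter f n x)
  iter-+ zero    n x = refl
  iter-+ (suc m) n x = cong f (iter-+ m n x)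

  iter-suc : ∀ n x → iter f (suc n) x ≡ iter f n (f x)
  iter-suc zero    x = refl
  iter-suc (suc n) x = cong f (iter-suc n x)

  iter-*-periodic : ∀ {p u} → iter f p u ≡ u → ∀ k → iter f (k * p) u ≡ u
  iter-*-periodic pu zero    = refl
  iter-*-periodic {p} {u} pu (suc k) = begin
    iter f (p + k * p) u       ≡⟨ iter-+ p (k * p) u ⟩
    iter f p (iter f (k * p) u) ≡⟨ cong (iter f p) (iter-*-periodic pu k) ⟩
    iter f p u                 ≡⟨ pu ⟩
    u                          ∎
    where open ≡-Reasoning

  iter-fixes-0 : f 0 ≡ 0 → ∀ n → iter f n 0 ≡ 0
  iter-fixes-0 f0 zero    = refl
  iter-fixes-0 f0 (suc n) = trans (cong f (iter-fixes-0 f0 n)) f0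

  IsUInt⇒f-positive : f 0 ≡ 0 → ∀ {u h} → 1 ≤ u → IsUInt f u h → 1 ≤ f h
  IsUInt⇒f-positive f0 {u} {h} 1≤u (suc s , _ , sh≡u) = n≢0⇒n>0 λ fh≡0 →
    <⇒≢ 1≤u (sym (begin
      u                 ≡⟨ sh≡u ⟨
      iter f (suc s) h  ≡⟨ iter-suc s h ⟩
      iter f s (f h)    ≡⟨ cong (iter f s) fh≡0 ⟩
      iter f s 0        ≡⟨ iter-fixes-0 f0 s ⟩
      0                 ∎))
    where open ≡-Reasoning

  -- h reaches u after s steps and then stays on its cycle, and j · p + s ≥ j.
  concurrent-of-iter≡ : ∀ {u l h} j → iter f j l ≡ iter f j h → IsUInt f u h →
    (Σ ℕ λ p → 1 ≤ p × iter f p u ≡ u) → ConcUInt f u l h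
  concurrent-of-iter≡ {u} {l} {h} j jl≡jh (s , 1≤s , sh≡u) (suc p , _ , pu≡u) =
    j * suc p + s , ≤-trans 1≤s (m≤n+m s _) , reach-l , reach-h
    where
      open ≡-Reasoning
      split : ∀ j p s → j * suc p + s ≡ (j * p + s) + j
      split = solve-∀
      reach-h : iter f (j * suc p + s) h ≡ u
      reach-h = begin
        iter f (j * suc p + s) h          ≡⟨ iter-+ (j * suc p) s h ⟩
        iter f (j * suc p) (iter f s h)   ≡⟨ cong (iter f (j * suc p)) sh≡u ⟩
        iter f (j * suc p) u              ≡⟨ iter-*-periodic pu≡u j ⟩
        u                                 ∎
      reach-l : iter f (j * suc p + s) l ≡ u
      reach-l = begin
        iter f (j * suc p + s) l          ≡⟨ cong (λ r → iter f r l) (split j p s) ⟩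
        iter f (j * p + s + j) l          ≡⟨ iter-+ (j * p + s) j l ⟩
        iter f (j * p + s) (iter f j l)   ≡⟨ cong (iter f (j * p + s)) jl≡jh ⟩
        iter f (j * p + s) (iter f j h)   ≡⟨ iter-+ (j * p + s) j h ⟨
        iter f (j * p + s + j) h          ≡⟨ cong (λ r → iter f r h) (split j p s) ⟨
        iter f (j * suc p + s) h          ≡⟨ reach-h ⟩
        u                                 ∎

  ConcUInt⇒IsUInt : ∀ {u l h} → ConcUInt f u l h → IsUInt f u l
  ConcUInt⇒IsUInt (r , 1≤r , rl≡u , _) = r , 1≤r , rl≡u

module Congruence where
  import Data.Nat as ℕ
  import Data.Nat.Properties as ℕ
  open import Data.Nat.DivMod using (m≡m%n+[m/n]*n; _mod_)
  open import Data.Nat.GCD using (gcd; gcd-GCD; GCD; module Bézout; gcd-identityʳ)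
  open import Data.Nat.Coprimality using (Coprime)
  open import Data.Integer hiding (_%_; _/_)
  open import Data.Integer.Properties
  open import Data.Integer.DivMod using (_%ℕ_; _/ℕ_; n%ℕd<d; a≡a%ℕn+[a/ℕn]*n)
  open import Data.Integer.Divisibility using (_∣_)
  open import Data.Integer.Divisibility.Signed as Signed using (divides; ∣ᵤ⇒∣; ∣⇒∣ᵤ)
  import Data.Integer.Coprimality as ℤ
  open import Data.Integer.Tactic.RingSolver using (solve-∀)
  open import Data.Fin.Properties using (pigeonhole; fromℕ<-injective)
  open import Data.Product using (_,_)
  open import Function.Base using (_∘_)
  open import Level using (0ℓ)
  open import Relation.Binary.Bundles using (Setoid)
  open import Relation.Binary.PropositionalEquality hiding (J)
  open import Relation.Nullary using (contradiction)

  infix 4 _≡_[mod_]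
  record _≡_[mod_] (x y : ℤ) (n : ℕ) : Set where
    constructor mk≡[mod]
    field modulus∣difference : + n ∣ x - y

  open _≡_[mod_] public

  module _ {n : ℕ} where

    private
      signed : ∀ {x y} → x ≡ y [mod n ] → + n Signed.∣ x - y
      signed = ∣ᵤ⇒∣ ∘ modulus∣difference

      unsigned : ∀ {x y} → + n Signed.∣ x - y → x ≡ y [mod n ]
      unsigned = mk≡[mod] ∘ ∣⇒∣ᵤ

    ≡-multiple⇒≡[mod] : ∀ {x y} q → x ≡ y + q * + n → x ≡ y [mod n ]
    ≡-multiple⇒≡[mod] {x} {y} q x≡y+qn = unsigned (divides q (begin
      x - y             ≡⟨ cong (_- y) x≡y+qn ⟩
      y + q * + n - y   ≡⟨ cancel y (q * + n) ⟩
      q * + n           ∎))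
      where
        open ≡-Reasoning
        cancel : ∀ y z → y + z - y ≡ z
        cancel = solve-∀

    ≡⇒≡[mod] : ∀ {x y} → x ≡ y → x ≡ y [mod n ]
    ≡⇒≡[mod] {x} {y} x≡y = ≡-multiple⇒≡[mod] 0ℤ (trans x≡y (sym (+-identityʳ y)))

    ≡[mod]-sym : ∀ {x y} → x ≡ y [mod n ] → y ≡ x [mod n ]
    ≡[mod]-sym {x} {y} x≡y = unsigned
      (subst (+ n Signed.∣_) (neg-minus x y) (Signed.∣m⇒∣-m (signed x≡y)))
      where
        neg-minus : ∀ x y → - (x - y) ≡ y - x
        neg-minus = solve-∀

    ≡[mod]-trans : ∀ {x y z} → x ≡ y [mod n ] → y ≡ z [mod n ] → x ≡ z [mod n ]
    ≡[mod]-trans {x} {y} {z} x≡y y≡z = unsigned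
      (subst (+ n Signed.∣_) (telescope x y z) (Signed.∣m∣n⇒∣m+n (signed x≡y) (signed y≡z)))
      where
        telescope : ∀ x y z → (x - y) + (y - z) ≡ x - z
        telescope = solve-∀

    +-congˡ-[mod] : ∀ z {x y} → x ≡ y [mod n ] → z + x ≡ z + y [mod n ]
    +-congˡ-[mod] z {x} {y} (mk≡[mod] n∣x-y) = mk≡[mod] (subst (+ n ∣_) (cancel z x y) n∣x-y)
      where
        cancel : ∀ z x y → x - y ≡ (z + x) - (z + y)
        cancel = solve-∀

    +-congʳ-[mod] : ∀ z {x y} → x ≡ y [mod n ] → x + z ≡ y + z [mod n ]
    +-congʳ-[mod] z {x} {y} x≡y =
      subst₂ (_≡_[mod n ]) (+-comm z x) (+-comm z y) (+-congˡ-[mod] z x≡y)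

    *-congˡ-[mod] : ∀ z {x y} → x ≡ y [mod n ] → z * x ≡ z * y [mod n ]
    *-congˡ-[mod] z {x} {y} x≡y = unsigned
      (subst (+ n Signed.∣_) (*-distribˡ-minus z x y) (Signed.∣n⇒∣m*n z (signed x≡y)))
      where
        *-distribˡ-minus : ∀ z x y → z * (x - y) ≡ z * x - z * y
        *-distribˡ-minus = solve-∀

    *-congʳ-[mod] : ∀ z {x y} → x ≡ y [mod n ] → x * z ≡ y * z [mod n ]
    *-congʳ-[mod] z {x} {y} x≡y =
      subst₂ (_≡_[mod n ]) (*-comm z x) (*-comm z y) (*-congˡ-[mod] z x≡y)

    neg-cong-[mod] : ∀ {x y} → x ≡ y [mod n ] → - x ≡ - y [mod n ]
    neg-cong-[mod] {x} {y} x≡y =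
      subst₂ (_≡_[mod n ]) (-1*i≡-i x) (-1*i≡-i y) (*-congˡ-[mod] -1ℤ x≡y)

  ≡[mod]-setoid : ℕ → Setoid 0ℓ 0ℓ
  ≡[mod]-setoid n = record
    { Carrier = ℤ
    ; _≈_ = _≡_[mod n ]
    ; isEquivalence = record { refl = ≡⇒≡[mod] refl ; sym = ≡[mod]-sym ; trans = ≡[mod]-trans }
    }

  %-≡[mod] : ∀ x n .{{_ : ℕ.NonZero n}} → + (x ℕ.% n) ≡ + x [mod n ]
  %-≡[mod] x n = ≡[mod]-sym (≡-multiple⇒≡[mod] (+ (x ℕ./ n)) (begin
    + x                             ≡⟨ cong +_ (m≡m%n+[m/n]*n x n) ⟩
    + (x ℕ.% n ℕ.+ x ℕ./ n ℕ.* n)       ≡⟨ pos-+ (x ℕ.% n) (x ℕ./ n ℕ.* n) ⟩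
    + (x ℕ.% n) + + (x ℕ./ n ℕ.* n)     ≡⟨ cong (λ r → + (x ℕ.% n) + r) (pos-* (x ℕ./ n) n) ⟩
    + (x ℕ.% n) + + (x ℕ./ n) * + n     ∎))
    where open ≡-Reasoning

  %ℕ-≡[mod] : ∀ z n .{{_ : ℕ.NonZero n}} → + (z %ℕ n) ≡ z [mod n ]
  %ℕ-≡[mod] z n = ≡[mod]-sym (≡-multiple⇒≡[mod] (z /ℕ n) (a≡a%ℕn+[a/ℕn]*n z n))

  gcd≡1⇒nonZero : ∀ {m n} → 1 ℕ.< m → gcd m n ≡ 1 → ℕ.NonZero n
  gcd≡1⇒nonZero {m} {ℕ.zero}  1<m gcd≡1 = contradiction (trans (sym (gcd-identityʳ m)) gcd≡1) (ℕ.>⇒≢ 1<m)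
  gcd≡1⇒nonZero {m} {ℕ.suc n} 1<m gcd≡1 = _

  gcd≡1⇒∃inverse : ∀ x n → gcd x n ≡ 1 → ∃ λ v → v * + x ≡ 1ℤ [mod n ]
  gcd≡1⇒∃inverse x n gcd≡1 with Bézout.identity (subst (GCD x n) gcd≡1 (gcd-GCD x n))
  ... | Bézout.+- v q 1+qn≡vx = + v , ≡-multiple⇒≡[mod] (+ q) (begin
    + v * + x             ≡⟨ pos-* v x ⟨
    + (v ℕ.* x)           ≡⟨ cong +_ 1+qn≡vx ⟨
    + (1 ℕ.+ q ℕ.* n)     ≡⟨ pos-+ 1 (q ℕ.* n) ⟩
    1ℤ + + (q ℕ.* n)      ≡⟨ cong (λ r → 1ℤ + r) (pos-* q n) ⟩
    1ℤ + + q * + n        ∎)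
    where open ≡-Reasoning
  ... | Bézout.-+ v q 1+vx≡qn = - + v , ≡-multiple⇒≡[mod] (- + q) (begin
    - + v * + x                 ≡⟨ negate (+ v) (+ x) ⟩
    1ℤ - (1ℤ + + v * + x)       ≡⟨ cong (λ r → 1ℤ - (1ℤ + r)) (pos-* v x) ⟨
    1ℤ - (1ℤ + + (v ℕ.* x))     ≡⟨ cong (λ r → 1ℤ - r) (pos-+ 1 (v ℕ.* x)) ⟨
    1ℤ - + (1 ℕ.+ v ℕ.* x)      ≡⟨ cong (λ r → 1ℤ - + r) 1+vx≡qn ⟩
    1ℤ - + (q ℕ.* n)            ≡⟨ cong (λ r → 1ℤ - r) (pos-* q n) ⟩
    1ℤ - + q * + n              ≡⟨ cong (λ r → 1ℤ + r) (neg-distribˡ-* (+ q) (+ n)) ⟩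
    1ℤ + - + q * + n            ∎)
    where
      open ≡-Reasoning
      negate : ∀ v x → - v * x ≡ 1ℤ - (1ℤ + v * x)
      negate = solve-∀

  gcd[∣c∣,n]≡1⇒∃inverse : ∀ c n → gcd ∣ c ∣ n ≡ 1 → ∃ λ v → v * c ≡ 1ℤ [mod n ]
  gcd[∣c∣,n]≡1⇒∃inverse (+ x) n gcd≡1 = gcd≡1⇒∃inverse x n gcd≡1
  gcd[∣c∣,n]≡1⇒∃inverse -[1+ x ] n gcd≡1 with gcd≡1⇒∃inverse (ℕ.suc x) n gcd≡1
  ... | v , v[1+x]≡1 = - v , subst (_≡ 1ℤ [mod n ]) (neg-swap v (+ ℕ.suc x)) v[1+x]≡1
    where
      neg-swap : ∀ v y → v * y ≡ - v * - y
      neg-swap = solve-∀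

  ∃small-solution : ∀ c t n .{{_ : ℕ.NonZero n}} → gcd ∣ c ∣ n ≡ 1 →
    ∃ λ k → k ℕ.< n × + k * c ≡ t [mod n ]
  ∃small-solution c t n gcd≡1 with gcd[∣c∣,n]≡1⇒∃inverse c n gcd≡1
  ... | v , vc≡1 = k , n%ℕd<d (t * v) n , (begin
    + k * c          ≈⟨ *-congʳ-[mod] c (%ℕ-≡[mod] (t * v) n) ⟩
    t * v * c        ≡⟨ *-assoc t v c ⟩
    t * (v * c)      ≈⟨ *-congˡ-[mod] t vc≡1 ⟩
    t * 1ℤ           ≡⟨ *-identityʳ t ⟩
    t                ∎)
    where
      open import Relation.Binary.Reasoning.Setoid (≡[mod]-setoid n)
      k : ℕ
      k = (t * v) %ℕ n

  coprime-cancelˡ-[mod] : ∀ {n b x y} → Coprime n b → + b * x ≡ + b * y [mod n ] → x ≡ y [mod n ]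
  coprime-cancelˡ-[mod] {n} {b} {x} {y} n⊥b (mk≡[mod] n∣bx-by) =
    mk≡[mod] (ℤ.coprime-divisor (+ n) (+ b) (x - y) n⊥b (subst (+ n ∣_) (*-distribˡ-minus (+ b) x y) n∣bx-by))
    where
      *-distribˡ-minus : ∀ z x y → z * x - z * y ≡ z * (x - y)
      *-distribˡ-minus = solve-∀

  coprime-cancelˡ-^-[mod] : ∀ {n b} → Coprime n b → ∀ i {x y} →
    + (b ℕ.^ i) * x ≡ + (b ℕ.^ i) * y [mod n ] → x ≡ y [mod n ]
  coprime-cancelˡ-^-[mod] n⊥b ℕ.zero {x} {y} = subst₂ (_≡_[mod _ ]) (*-identityˡ x) (*-identityˡ y)
  coprime-cancelˡ-^-[mod] {n} {b} n⊥b (ℕ.suc i) {x} {y} bᵢ₊₁x≡bᵢ₊₁y =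
    coprime-cancelˡ-^-[mod] n⊥b i (coprime-cancelˡ-[mod] n⊥b
      (subst₂ (_≡_[mod n ]) (split x) (split y) bᵢ₊₁x≡bᵢ₊₁y))
    where
      split : ∀ z → + (b ℕ.* b ℕ.^ i) * z ≡ + b * (+ (b ℕ.^ i) * z)
      split z = trans (cong (_* z) (pos-* b (b ℕ.^ i))) (*-assoc (+ b) (+ (b ℕ.^ i)) z)

  coprime⇒∃power≡1 : ∀ n b .{{_ : ℕ.NonZero n}} → Coprime n b →
    ∃ λ p → + (b ℕ.^ ℕ.suc p) ≡ 1ℤ [mod n ]
  coprime⇒∃power≡1 n b n⊥b with pigeonhole (ℕ.n<1+n n) (λ i → (b ℕ.^ toℕ i) mod n)
  ... | i , j , i<j , same-residue = p , coprime-cancelˡ-^-[mod] n⊥b I (begin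
    + (b ℕ.^ I) * + (b ℕ.^ ℕ.suc p)   ≡⟨ pos-* (b ℕ.^ I) _ ⟨
    + (b ℕ.^ I ℕ.* b ℕ.^ ℕ.suc p)     ≡⟨ cong +_ (ℕ.^-distribˡ-+-* b I (ℕ.suc p)) ⟨
    + (b ℕ.^ (I ℕ.+ ℕ.suc p))         ≡⟨ cong (λ e → + (b ℕ.^ e)) I+[1+p]≡J ⟩
    + (b ℕ.^ J)                       ≈⟨ %-≡[mod] (b ℕ.^ J) n ⟨
    + (b ℕ.^ J ℕ.% n)                 ≡⟨ cong +_ (fromℕ<-injective _ _ _ _ same-residue) ⟨
    + (b ℕ.^ I ℕ.% n)                 ≈⟨ %-≡[mod] (b ℕ.^ I) n ⟩
    + (b ℕ.^ I)                       ≡⟨ *-identityʳ _ ⟨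
    + (b ℕ.^ I) * 1ℤ                  ∎)
    where
      open import Relation.Binary.Reasoning.Setoid (≡[mod]-setoid n)
      I J p : ℕ
      I = toℕ i
      J = toℕ j
      p = J ℕ.∸ ℕ.suc I
      I+[1+p]≡J : I ℕ.+ ℕ.suc p ≡ J
      I+[1+p]≡J = trans (ℕ.+-suc I p) (ℕ.m+[n∸m]≡n i<j)

module Numerals (b : ℕ) where
  open import Data.Nat
  open import Data.Nat.Properties

  n<b^n : 1 < b → ∀ n → n < b ^ n
  n<b^n 1<b zero    = s≤s z≤n
  n<b^n 1<b (suc n) = begin-strict
    suc n      ≤⟨ n<b^n 1<b n ⟩
    b ^ n      <⟨ m<m*n (b ^ n) b 1<b ⟩
    b ^ n * b  ≡⟨ *-comm (b ^ n) b ⟩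
    b * b ^ n  ∎
    where
      open ≤-Reasoning
      instance
        b^n≢0 : NonZero (b ^ n)
        b^n≢0 = m^n≢0 b n ⦃ >-nonZero (<-trans z<s 1<b) ⦄

  n<y*b^n : 1 < b → ∀ {y} → 1 ≤ y → ∀ n → n < y * b ^ n
  n<y*b^n 1<b {y} 1≤y n = <-≤-trans (n<b^n 1<b n) (m≤n*m (b ^ n) y ⦃ >-nonZero 1≤y ⦄)

  -- the base-b numeral of x, followed by p zeros and the digit d
  appendDigit : ℕ → ℕ → ℕ → ℕ
  appendDigit p x d = d + x * b ^ p * b

  appendDigits : ℕ → ℕ → ℕ → ℕ → ℕ
  appendDigits p d zero    x = x
  appendDigits p d (suc k) x = appendDigit p (appendDigits p d k x) d

module DigitMap (b : ℕ) ⦃ _ : NonZero b ⦄ (1<b : 1 < b) (fstar : Fin b → ℕ)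
                (f[0]≡0 : digitMap b fstar 0 ≡ 0) where
  open import Data.Nat
  open import Data.Nat.Properties
  open import Data.Nat.DivMod
  open import Data.Nat.Divisibility using (divides)
  open import Data.Fin.Properties using (fromℕ<-cong)
  open import Relation.Binary.PropositionalEquality

  open Numerals b public

  private
    f : ℕ → ℕ
    f = digitMap b fstar

  private
    /b<self : ∀ n → suc n / b < suc n
    /b<self n = m/n<m (suc n) b 1<b

  digitSumAux-fuel : ∀ k k′ n → n ≤ k → n ≤ k′ → digitSumAux b fstar k n ≡ digitSumAux b fstar k′ n
  digitSumAux-fuel zero    zero     zero    _ _ = refl
  digitSumAux-fuel zero    (suc k′) zero    _ _ = refl
  digitSumAux-fuel (suc k) zero     zero    _ _ = refl
  digitSumAux-fuel (suc k) (suc k′) zero    _ _ = refl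
  digitSumAux-fuel (suc k) (suc k′) (suc n) (s≤s n≤k) (s≤s n≤k′) =
    cong (fstar (suc n mod b) +_) (digitSumAux-fuel k k′ (suc n / b) (≤-trans q≤n n≤k) (≤-trans q≤n n≤k′))
    where
      q≤n : suc n / b ≤ n
      q≤n = s≤s⁻¹ (/b<self n)

  digitSumAux≡digitMap : ∀ k n → n ≤ k → digitSumAux b fstar k n ≡ f n
  digitSumAux≡digitMap zero    zero    _   = sym f[0]≡0
  digitSumAux≡digitMap (suc k) zero    _   = sym f[0]≡0
  digitSumAux≡digitMap k       (suc n) n<k = digitSumAux-fuel k (suc n) (suc n) n<k ≤-refl

  digitMap-step : ∀ n → f n ≡ fstar (n mod b) + f (n / b)
  digitMap-step zero = begin
    fstar (0 mod b)             ≡⟨ +-identityʳ _ ⟨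
    fstar (0 mod b) + 0         ≡⟨ cong (fstar (0 mod b) +_) f[0]≡0 ⟨
    fstar (0 mod b) + f 0       ≡⟨ cong (λ q → fstar (0 mod b) + f q) (0/n≡0 b) ⟨
    fstar (0 mod b) + f (0 / b) ∎
    where open ≡-Reasoning
  digitMap-step (suc n) =
    cong (fstar (suc n mod b) +_) (digitSumAux≡digitMap n (suc n / b) (s≤s⁻¹ (/b<self n)))

  digitMap-digit : ∀ {d} → d < b → f d ≡ fstar (d mod b)
  digitMap-digit {d} d<b = begin
    f d                         ≡⟨ digitMap-step d ⟩
    fstar (d mod b) + f (d / b) ≡⟨ cong (λ q → fstar (d mod b) + f q) (m<n⇒m/n≡0 d<b) ⟩
    fstar (d mod b) + f 0       ≡⟨ cong (fstar (d mod b) +_) f[0]≡0 ⟩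
    fstar (d mod b) + 0         ≡⟨ +-identityʳ _ ⟩
    fstar (d mod b)             ∎
    where open ≡-Reasoning

  digitMap-+digit : ∀ n {d} → d < b → f (d + n * b) ≡ f n + f d
  digitMap-+digit n {d} d<b = begin
    f (d + n * b)                                       ≡⟨ digitMap-step (d + n * b) ⟩
    fstar ((d + n * b) mod b) + f ((d + n * b) / b)     ≡⟨ cong₂ _+_ (cong fstar last-digit) (cong f leading-digits) ⟩
    fstar (d mod b) + f n                               ≡⟨ +-comm _ (f n) ⟩
    f n + fstar (d mod b)                               ≡⟨ cong (f n +_) (digitMap-digit d<b) ⟨
    f n + f d                                           ∎
    where
      open ≡-Reasoning
      last-digit : (d + n * b) mod b ≡ d mod b
      last-digit = fromℕ<-cong _ _ ([m+kn]%n≡m%n d n b) _ _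
      leading-digits : (d + n * b) / b ≡ n
      leading-digits = begin
        (d + n * b) / b     ≡⟨ +-distrib-/-∣ʳ d (divides n refl) ⟩
        d / b + n * b / b   ≡⟨ cong₂ _+_ (m<n⇒m/n≡0 d<b) (m*n/n≡m n b) ⟩
        n                   ∎

  digitMap-*b^ : ∀ n j → f (n * b ^ j) ≡ f n
  digitMap-*b^ n zero    = cong f (*-identityʳ n)
  digitMap-*b^ n (suc j) = begin
    f (n * (b * b ^ j))     ≡⟨ cong f (shift n (b ^ j)) ⟩
    f (0 + n * b ^ j * b)   ≡⟨ digitMap-+digit (n * b ^ j) (>-nonZero⁻¹ b) ⟩
    f (n * b ^ j) + f 0     ≡⟨ cong₂ _+_ (digitMap-*b^ n j) f[0]≡0 ⟩
    f n + 0                 ≡⟨ +-identityʳ (f n) ⟩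
    f n                     ∎
    where
      open ≡-Reasoning
      shift : ∀ n c → n * (b * c) ≡ 0 + n * c * b
      shift n c = trans (cong (n *_) (*-comm b c)) (sym (*-assoc n c b))

  digitMap-appendDigit : ∀ p x {d} → d < b → f (appendDigit p x d) ≡ f x + f d
  digitMap-appendDigit p x d<b =
    trans (digitMap-+digit (x * b ^ p) d<b) (cong (_+ _) (digitMap-*b^ x p))

  digitMap-appendDigits : ∀ p {d} → d < b → ∀ k x → f (appendDigits p d k x) ≡ f x + k * f d
  digitMap-appendDigits p {d} d<b zero    x = sym (+-identityʳ (f x))
  digitMap-appendDigits p {d} d<b (suc k) x = begin
    f (appendDigit p (appendDigits p d k x) d)  ≡⟨ digitMap-appendDigit p (appendDigits p d k x) d<b ⟩
    f (appendDigits p d k x) + f d              ≡⟨ cong (_+ f d) (digitMap-appendDigits p d<b k x) ⟩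
    f x + k * f d + f d                         ≡⟨ +-assoc (f x) _ _ ⟩
    f x + (k * f d + f d)                       ≡⟨ cong (f x +_) (+-comm (k * f d) (f d)) ⟩
    f x + suc k * f d                           ∎
    where open ≡-Reasoning

  digitMap-positive⇒positive : ∀ {x} → 1 ≤ f x → 1 ≤ x
  digitMap-positive⇒positive {zero}  1≤f0 = subst (1 ≤_) f[0]≡0 1≤f0
  digitMap-positive⇒positive {suc x} _    = s≤s z≤n

module NumeralResidues (b : ℕ) where
  import Data.Nat as ℕ
  import Data.Nat.Properties as ℕ
  open import Data.Integer
  open import Data.Integer.Properties
  open import Data.Integer.Tactic.RingSolver using (solve-∀)
  open import Relation.Binary.PropositionalEquality
  open Congruence
  open Numerals b

  module _ (n p : ℕ) (b^[1+p]≡1 : + (b ℕ.^ ℕ.suc p) ≡ 1ℤ [mod n ]) where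

    appendDigit-≡[mod] : ∀ x d → + appendDigit p x d ≡ + x + + d [mod n ]
    appendDigit-≡[mod] x d = begin
      + (d ℕ.+ x ℕ.* b ℕ.^ p ℕ.* b)         ≡⟨ cong (λ y → + (d ℕ.+ y)) (ℕ.*-assoc x (b ℕ.^ p) b) ⟩
      + (d ℕ.+ x ℕ.* (b ℕ.^ p ℕ.* b))       ≡⟨ cong (λ y → + (d ℕ.+ x ℕ.* y)) (ℕ.*-comm (b ℕ.^ p) b) ⟩
      + (d ℕ.+ x ℕ.* b ℕ.^ ℕ.suc p)         ≡⟨ pos-+ d _ ⟩
      + d + + (x ℕ.* b ℕ.^ ℕ.suc p)         ≡⟨ cong (λ y → + d + y) (pos-* x _) ⟩
      + d + + x * + (b ℕ.^ ℕ.suc p)         ≈⟨ +-congˡ-[mod] (+ d) (*-congˡ-[mod] (+ x) b^[1+p]≡1) ⟩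
      + d + + x * 1ℤ                        ≡⟨ swap (+ d) (+ x) ⟩
      + x + + d                             ∎
      where
        open import Relation.Binary.Reasoning.Setoid (≡[mod]-setoid n)
        swap : ∀ d x → d + x * 1ℤ ≡ x + d
        swap = solve-∀

    appendDigits-≡[mod] : ∀ d k x → + appendDigits p d k x ≡ + x + + k * + d [mod n ]
    appendDigits-≡[mod] d ℕ.zero    x = ≡⇒≡[mod] (sym (+-identityʳ (+ x)))
    appendDigits-≡[mod] d (ℕ.suc k) x = begin
      + appendDigit p (appendDigits p d k x) d    ≈⟨ appendDigit-≡[mod] (appendDigits p d k x) d ⟩
      + appendDigits p d k x + + d                ≈⟨ +-congʳ-[mod] (+ d) (appendDigits-≡[mod] d k x) ⟩
      + x + + k * + d + + d                       ≡⟨ regroup (+ x) (+ k) (+ d) ⟩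
      + x + (1ℤ + + k) * + d                      ≡⟨ cong (λ y → + x + y * + d) (pos-+ 1 k) ⟨
      + x + + ℕ.suc k * + d                       ∎
      where
        open import Relation.Binary.Reasoning.Setoid (≡[mod]-setoid n)
        regroup : ∀ x k d → x + k * d + d ≡ x + (1ℤ + k) * d
        regroup = solve-∀

module Preimage (b : ℕ) ⦃ _ : NonZero b ⦄ (1<b : 1 < b) (fstar : Fin b → ℕ)
                (f[0]≡0 : digitMap b fstar 0 ≡ 0) (f[1]≡1 : digitMap b fstar 1 ≡ 1) where
  import Data.Nat as ℕ
  import Data.Nat.Properties as ℕ
  open import Data.Nat.Coprimality using (Coprime)
  open import Data.Nat.GCD using (gcd)
  open import Data.Fin.Properties using (toℕ<n)
  open import Data.Integer hiding (_%_; _/_)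
  open import Data.Integer.Properties
  open import Data.Integer.Tactic.RingSolver using (solve-∀)
  open import Data.Product using (_,_)
  open import Relation.Binary.PropositionalEquality
  open Congruence
  open DigitMap b 1<b fstar f[0]≡0
  open NumeralResidues b

  private
    f : ℕ → ℕ
    f = digitMap b fstar

  module _ (n p : ℕ) (b^[1+p]≡1 : + (b ℕ.^ ℕ.suc p) ≡ 1ℤ [mod n ]) where

    numeral : ℕ → ℕ → ℕ → ℕ
    numeral m k N = appendDigits p 1 (N ℕ.∸ k ℕ.* f m) (appendDigits p m k 0)

    digitMap-numeral : ∀ {m} → m ℕ.< b → ∀ k N → k ℕ.* f m ℕ.≤ N → f (numeral m k N) ≡ N
    digitMap-numeral {m} m<b k N k·fm≤N = begin
      f (numeral m k N)                          ≡⟨ digitMap-appendDigits p 1<b o (appendDigits p m k 0) ⟩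
      f (appendDigits p m k 0) ℕ.+ o ℕ.* f 1     ≡⟨ cong₂ ℕ._+_ (digitMap-appendDigits p m<b k 0) (cong (o ℕ.*_) f[1]≡1) ⟩
      f 0 ℕ.+ k ℕ.* f m ℕ.+ o ℕ.* 1              ≡⟨ cong₂ (λ x y → x ℕ.+ k ℕ.* f m ℕ.+ y) f[0]≡0 (ℕ.*-identityʳ o) ⟩
      k ℕ.* f m ℕ.+ o                            ≡⟨ ℕ.m+[n∸m]≡n k·fm≤N ⟩
      N                                          ∎
      where
        open ≡-Reasoning
        o : ℕ
        o = N ℕ.∸ k ℕ.* f m

    numeral-≡[mod] : ∀ m k N → k ℕ.* f m ℕ.≤ N → + numeral m k N ≡ + N - + k * (+ f m - + m) [mod n ]
    numeral-≡[mod] m k N k·fm≤N = begin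
      + numeral m k N                         ≈⟨ appendDigits-≡[mod] n p b^[1+p]≡1 1 o (appendDigits p m k 0) ⟩
      + appendDigits p m k 0 + + o * 1ℤ       ≈⟨ +-congʳ-[mod] (+ o * 1ℤ) (appendDigits-≡[mod] n p b^[1+p]≡1 m k 0) ⟩
      0ℤ + + k * + m + + o * 1ℤ               ≡⟨ regroup (+ o) (+ k) (+ m) (+ f m) ⟩
      + k * + f m + + o - + k * (+ f m - + m) ≡⟨ cong (_- + k * (+ f m - + m)) N-as-ℤ ⟩
      + N - + k * (+ f m - + m)               ∎
      where
        open import Relation.Binary.Reasoning.Setoid (≡[mod]-setoid n)
        o : ℕ
        o = N ℕ.∸ k ℕ.* f m
        N-as-ℤ : + k * + f m + + o ≡ + N
        N-as-ℤ = trans (cong (λ y → y + + o) (sym (pos-* k (f m))))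
                   (trans (sym (pos-+ (k ℕ.* f m) o)) (cong +_ (ℕ.m+[n∸m]≡n k·fm≤N)))
        regroup : ∀ o k m fm → 0ℤ + k * m + o * 1ℤ ≡ k * fm + o - k * (fm - m)
        regroup = solve-∀

  digitMap-preimage-≡[mod] : ∀ n .⦃ _ : ℕ.NonZero n ⦄ → Coprime n b → (m : Fin b) →
    gcd ∣ + f (toℕ m) - + toℕ m ∣ n ≡ 1 →
    ∀ N → n ℕ.* f (toℕ m) ℕ.< N → ∀ a → ∃ λ l → 1 ℕ.≤ l × f l ≡ N × (+ l ≡ a [mod n ])
  digitMap-preimage-≡[mod] n n⊥b mstar gcd≡1 N n·fm<N a =
    let p , b^[1+p]≡1     = coprime⇒∃power≡1 n b n⊥b
        k , k<n , k·c≡N-a = ∃small-solution (+ f m - + m) (+ N - a) n gcd≡1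

        k·fm≤N : k ℕ.* f m ℕ.≤ N
        k·fm≤N = ℕ.≤-trans (ℕ.*-monoˡ-≤ (f m) (ℕ.<⇒≤ k<n)) (ℕ.<⇒≤ n·fm<N)

        l : ℕ
        l = numeral n p b^[1+p]≡1 m k N

        f[l]≡N : f l ≡ N
        f[l]≡N = digitMap-numeral n p b^[1+p]≡1 (toℕ<n mstar) k N k·fm≤N
    in  l
      , digitMap-positive⇒positive {l} (subst (1 ℕ.≤_) (sym f[l]≡N) (ℕ.≤-<-trans ℕ.z≤n n·fm<N))
      , f[l]≡N
      , ≡[mod]-trans (numeral-≡[mod] n p b^[1+p]≡1 m k N k·fm≤N) (N-minus-≡[mod] k·c≡N-a)
    where
      m : ℕ
      m = toℕ mstar

      N-minus-≡[mod] : ∀ {x} → x ≡ + N - a [mod n ] → + N - x ≡ a [mod n ]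
      N-minus-≡[mod] x≡N-a =
        ≡[mod]-trans (+-congˡ-[mod] (+ N) (neg-cong-[mod] x≡N-a)) (≡⇒≡[mod] (cancel (+ N) a))
        where
          cancel : ∀ N a → N - (N - a) ≡ a
          cancel = solve-∀

open import Data.Integer using (ℤ; +_; _-_; ∣_∣)
open import Data.Integer.Divisibility using (_∣_)
open import Data.Nat using (_∸_; _*_; _^_)
open import Data.Nat.Coprimality as Coprimality using (Coprime; gcd≡1⇒coprime)
open import Data.Nat.GCD using (gcd)
open import Data.Product using (_,_)
open import Relation.Binary.PropositionalEquality using (cong; trans)
open Congruence using (gcd≡1⇒nonZero; modulus∣difference)

lemma2p3 : (b : ℕ) → ⦃ _ : NonZero b ⦄ → 2 ≤ b → (fstar : Fin b → ℕ) →
    digitMap b fstar 0 ≡ 0 →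
    digitMap b fstar 1 ≡ 1 →
    gcd b (digitMap b fstar (b ∸ 1)) ≡ 1 →
    (Σ (Fin b) λ mstar →
      gcd ∣ + digitMap b fstar (toℕ mstar) - + toℕ mstar ∣ (digitMap b fstar (b ∸ 1)) ≡ 1) →
    (u : ℕ) → 1 ≤ u →
    (Σ ℕ λ r → (1 ≤ r) × (iter (digitMap b fstar) r u ≡ u)) →
    (h : ℕ) → 1 ≤ h → IsUInt (digitMap b fstar) u h →
    (a : ℤ) →
    Σ ℕ λ l → (1 ≤ l) × IsUInt (digitMap b fstar) u l
      × ((+ digitMap b fstar (b ∸ 1)) ∣ (+ l - a))
      × ConcUInt (digitMap b fstar) u l h
lemma2p3 b 1<b fstar f[0]≡0 f[1]≡1 gcd[b,F]≡1 (mstar , gcd[c,F]≡1) u 1≤u u-periodic h _ h-is-u a =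
  let l , 1≤l , f[l]≡N , l≡a = digitMap-preimage-≡[mod] F ⦃ F≢0 ⦄ F⊥b mstar gcd[c,F]≡1 N J<N a

      l∼h : ConcUInt f u l h
      l∼h = concurrent-of-iter≡ 2 (trans (cong f f[l]≡N) (digitMap-*b^ (f h) J)) h-is-u u-periodic
  in  l , 1≤l , ConcUInt⇒IsUInt l∼h , modulus∣difference l≡a , l∼h
  where
    f : ℕ → ℕ
    f = digitMap b fstar

    open Iteration f
    open DigitMap b 1<b fstar f[0]≡0 using (digitMap-*b^; n<y*b^n)
    open Preimage b 1<b fstar f[0]≡0 f[1]≡1

    F J N : ℕ
    F = f (b ∸ 1)
    J = F * f (toℕ mstar)
    N = f h * b ^ J

    F≢0 : NonZero F
    F≢0 = gcd≡1⇒nonZero 1<b gcd[b,F]≡1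

    F⊥b : Coprime F b
    F⊥b = Coprimality.sym (gcd≡1⇒coprime gcd[b,F]≡1)

    J<N : J < N
    J<N = n<y*b^n 1<b (IsUInt⇒f-positive f[0]≡0 1≤u h-is-u) J
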